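{- Let $G$ be a decomposable cubic graph that has a bridge. Then $\mathrm{mms}(G)\ge \nu(G)-1$, where $\nu(G)$ is the size of a maximum matching of $G$.
   Context: All graphs are finite and simple; a cubic graph is one in which every vertex has degree $3$. A matching $M$ of $G$ is separating if $G-M$ has more connected components than $G$. A graph is decomposable if it has a separating matching (equivalently, a matching cut: a matching that equals the set of edges between $X$ and $V(G)\setminus X$ for some nonempty proper $X\subseteq V(G)$). $\mathrm{mms}(G)$ denotes the maximum size of a separating matching of $G$ (and $\mathrm{mms}(G)=0$ if none exists). A bridge is an edge whose removal increases the number of connected components. -}

module Defs where

open import Data.Nat using (ℕ; zero; suc; _+_; _≤_; _<_)
open import Data.Fin using (Fin; _≟_) renaming (_<_ to _<ᶠ_)
open import Data.Fin.Properties using () renaming (_<?_ to _<ᶠ?_)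
open import Data.Bool using (Bool; true; false; _∧_; _∨_; not; if_then_else_)
open import Data.List using (List; []; _∷_; length; map; allFin; concatMap; filter)
open import Data.Nat.ListAction using (sum)
open import Data.Bool.ListAction using (any; all)
open import Data.List.Relation.Unary.All using (All)
open import Data.List.Relation.Unary.Unique.Propositional using (Unique)
open import Data.Product using (Σ; _×_; _,_; proj₁; proj₂)
open import Relation.Binary.PropositionalEquality using (_≡_)
open import Relation.Nullary.Decidable using (⌊_⌋)

record Graph : Set where
  field
    n     : ℕ
    adj   : Fin n → Fin n → Bool
    sym   : ∀ u v → adj u v ≡ adj v u
    irrefl : ∀ v → adj v v ≡ false
open Graph public

degree : (G : Graph) → Fin (n G) → ℕ
degree G v = sum (map (λ u → if adj G v u then 1 else 0) (allFin (n G)))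

Cubic : Graph → Set
Cubic G = ∀ v → degree G v ≡ 3

EdgeList : Graph → Set
EdgeList G = List (Fin (n G) × Fin (n G))

endpoints : {G : Graph} → EdgeList G → List (Fin (n G))
endpoints = concatMap (λ e → proj₁ e ∷ proj₂ e ∷ [])

-- A matching: a list of edges of G whose endpoints are pairwise distinct
-- (so the edges are distinct and pairwise disjoint). Its size is its length.
IsMatching : (G : Graph) → EdgeList G → Set
IsMatching G M = All (λ e → adj G (proj₁ e) (proj₂ e) ≡ true) M × Unique (endpoints {G} M)

inEdges : {G : Graph} → EdgeList G → Fin (n G) → Fin (n G) → Bool
inEdges M u v = any (λ e → (⌊ proj₁ e ≟ u ⌋ ∧ ⌊ proj₂ e ≟ v ⌋) ∨ (⌊ proj₁ e ≟ v ⌋ ∧ ⌊ proj₂ e ≟ u ⌋)) M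

removeEdges : (G : Graph) → EdgeList G → Graph
removeEdges G M = record
  { n = n G
  ; adj = λ u v → adj G u v ∧ not (inEdges {G} M u v)
  ; sym = λ u v → symProof u v
  ; irrefl = λ v → irr v
  }
  where
  open import Relation.Binary.PropositionalEquality using (cong₂; refl; cong)
  open import Data.Bool.Properties using (∧-zeroˡ; ∨-comm)
  open import Data.Bool.Properties using (∧-comm)
  inSym : ∀ u v → inEdges {G} M u v ≡ inEdges {G} M v u
  inSym u v = go M
    where
    go : (L : EdgeList G) → inEdges {G} L u v ≡ inEdges {G} L v u
    go [] = refl
    go (e ∷ L) = cong₂ _∨_ (∨-comm (⌊ proj₁ e ≟ u ⌋ ∧ ⌊ proj₂ e ≟ v ⌋) (⌊ proj₁ e ≟ v ⌋ ∧ ⌊ proj₂ e ≟ u ⌋)) (go L)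
  symProof : ∀ u v → (adj G u v ∧ not (inEdges {G} M u v)) ≡ (adj G v u ∧ not (inEdges {G} M v u))
  symProof u v = cong₂ _∧_ (sym G u v) (cong not (inSym u v))
  irr : ∀ v → (adj G v v ∧ not (inEdges {G} M v v)) ≡ false
  irr v with adj G v v | irrefl G v
  ... | false | _ = refl

reachWithin : (G : Graph) → ℕ → Fin (n G) → Fin (n G) → Bool
reachWithin G zero u v = ⌊ u ≟ v ⌋
reachWithin G (suc k) u v =
  reachWithin G k u v ∨ any (λ w → reachWithin G k u w ∧ adj G w v) (allFin (n G))

-- u and v lie in the same connected component (paths have < n edges)
connected : (G : Graph) → Fin (n G) → Fin (n G) → Bool
connected G u v = reachWithin G (n G) u v

-- number of connected components = number of vertices that are the
-- least vertex of their component
components : Graph → ℕ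
components G =
  length (filter (λ v → Data.Bool._≟_ (all (λ w → not (⌊ w <ᶠ? v ⌋ ∧ connected G w v)) (allFin (n G))) true)
                 (allFin (n G)))
  where import Data.Bool

IsSeparatingMatching : (G : Graph) → EdgeList G → Set
IsSeparatingMatching G M = IsMatching G M × components G < components (removeEdges G M)

Decomposable : Graph → Set
Decomposable G = Σ (EdgeList G) (IsSeparatingMatching G)

HasBridge : Graph → Set
HasBridge G = Σ (Fin (n G)) λ u → Σ (Fin (n G)) λ v →
  adj G u v ≡ true × components G < components (removeEdges G ((u , v) ∷ []))

-- mms(G) ≥ k : some separating matching has size ≥ k
-- ν(G) ≤ m : every matching has size ≤ m

{-# OPTIONS --safe #-}
-- Let uv be a bridge and L a maximum matching of G − {u, v}. Then M = L + uv
-- is a matching, and G − M has at least as many components as G − uv, hence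
-- more than G: M is separating. A matching N has at most two edges meeting u
-- or v and the others form a matching of G − {u, v}, so |N| ≤ |L| + 2 = |M| + 1.
module Submission where

open import Defs
open import Level using (0ℓ)
open import Function using (id; _∘_; Equivalence)
open import Data.Sum as Sum using (_⊎_; inj₁; inj₂; [_,_]′)
open import Data.Product as Product using (Σ; _×_; _,_; proj₁; proj₂)
open import Data.Product.Properties using (≡-dec)
open import Data.Nat using (zero; suc; _+_; _≤_; _<_; _≤?_; z≤n; s≤s)
open import Data.Nat.Properties using (≤-trans; ≤-refl; ≤-reflexive; ≰⇒≥; <-≤-trans; +-comm; module ≤-Reasoning)
open import Data.Bool as Bool using (Bool; true; false; T; _∧_; _∨_; not)
open import Data.Bool.Properties using (T-≡; T-∨; T-∧)
open import Data.Bool.ListAction using (any; all)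
open import Data.Fin using (Fin; _≟_)
open import Data.Fin.Properties using () renaming (_<?_ to _<ᶠ?_)
open import Data.List using (List; []; _∷_; length; filter; allFin; cartesianProduct)
open import Data.List.Properties using (filter-accept; filter-reject; filter-all)
open import Data.List.Membership.Propositional using (_∈_)
open import Data.List.Membership.Propositional.Properties using (∈-filter⁻; ∈-allFin; ∈-cartesianProduct⁺)
open import Data.List.Relation.Binary.Subset.Propositional using (_⊆_)
open import Data.List.Relation.Binary.Subset.Propositional.Properties using (Any-resp-⊆; ∷⁺ʳ; ⊆∷∧∉⇒⊆)
import Data.List.Relation.Binary.Sublist.Propositional as Sublist
import Data.List.Relation.Binary.Sublist.Propositional.Properties as Sublist
open import Data.List.Relation.Unary.All as All using (All; []; _∷_)
import Data.List.Relation.Unary.All.Properties as All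
open import Data.List.Relation.Unary.AllPairs using (AllPairs; []; _∷_)
import Data.List.Relation.Unary.AllPairs.Properties as AllPairs
open import Data.List.Relation.Unary.Any as Any using (here; there)
open import Data.List.Relation.Unary.Any.Properties using (any⁺; any⁻)
open import Data.List.Relation.Unary.Unique.Propositional using (Unique)
open import Relation.Binary using (Rel; Symmetric; Decidable; DecidableEquality)
open import Relation.Binary.PropositionalEquality as ≡ using (_≡_; _≢_; refl; ≢-sym)
open import Relation.Nullary using (Dec; ¬_; yes; no; ¬?; contradiction)
open import Relation.Nullary.Decidable using (⌊_⌋)
open import Relation.Unary as U using (Pred; _∩_)
open import Relation.Unary.Properties using (_∩?_)

T-not-antitone : ∀ {a b} → (T a → T b) → T (not b) → T (not a)
T-not-antitone {false} _ _ = _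
T-not-antitone {true} {false} a⇒b _ = a⇒b _

T-∧-mono : ∀ {a a′ b b′} → (T a → T a′) → (T b → T b′) → T (a ∧ b) → T (a′ ∧ b′)
T-∧-mono f g = Equivalence.from T-∧ ∘ Product.map f g ∘ Equivalence.to T-∧

T-∨-mono : ∀ {a a′ b b′} → (T a → T a′) → (T b → T b′) → T (a ∨ b) → T (a′ ∨ b′)
T-∨-mono f g = Equivalence.from T-∨ ∘ Sum.map f g ∘ Equivalence.to T-∨

T-any-mono : ∀ {A : Set} {p q : A → Bool} → (∀ x → T (p x) → T (q x)) →
             ∀ xs → T (any p xs) → T (any q xs)
T-any-mono p⇒q xs = any⁺ _ ∘ Any.map (p⇒q _) ∘ any⁻ _ xs

T-all-mono : ∀ {A : Set} {p q : A → Bool} → (∀ x → T (p x) → T (q x)) →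
             ∀ xs → T (all p xs) → T (all q xs)
T-all-mono p⇒q xs = All.all⁻ _ ∘ All.map (p⇒q _) ∘ All.all⁺ _ xs

length≤suc-length-filter : ∀ {A : Set} {R : Rel A 0ℓ} {Q : Pred A 0ℓ} (Q? : U.Decidable Q) →
                           (∀ {x y} → R x y → Q x ⊎ Q y) →
                           ∀ {xs} → AllPairs R xs → length xs ≤ suc (length (filter Q? xs))
length≤suc-length-filter Q? R⇒Q [] = z≤n
length≤suc-length-filter {Q = Q} Q? R⇒Q {x ∷ xs} (x∼xs ∷ pairwise) with Q? x
... | yes _ = s≤s (length≤suc-length-filter Q? R⇒Q pairwise)
... | no ¬qx = s≤s (≤-reflexive (≡.cong length (≡.sym (filter-all Q? others))))
  where
  others : All Q xs
  others = All.map (λ x∼y → [ (λ qx → contradiction qx ¬qx) , id ]′ (R⇒Q x∼y)) x∼xs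

module LongestPairwise {A : Set} {R : Rel A 0ℓ} (R? : Decidable R) where

  longer : List A → List A → List A
  longer xs ys with length ys ≤? length xs
  ... | yes _ = xs
  ... | no _  = ys

  longer-preserves : (Q : List A → Set) → ∀ {xs ys} → Q xs → Q ys → Q (longer xs ys)
  longer-preserves Q {xs} {ys} qxs qys with length ys ≤? length xs
  ... | yes _ = qxs
  ... | no _  = qys

  length-longerˡ : ∀ xs ys → length xs ≤ length (longer xs ys)
  length-longerˡ xs ys with length ys ≤? length xs
  ... | yes _   = ≤-refl
  ... | no ys≰xs = ≰⇒≥ ys≰xs

  length-longerʳ : ∀ xs ys → length ys ≤ length (longer xs ys)
  length-longerʳ xs ys with length ys ≤? length xs
  ... | yes ys≤xs = ys≤xs
  ... | no _      = ≤-refl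

  PairwiseIn : Pred A 0ℓ → List A → List A → Set
  PairwiseIn P xs ys = ys ⊆ xs × All P ys × AllPairs R ys

  -- The predicate accumulates the constraint R x for each chosen x, keeping the recursion structural.
  longest : {P : Pred A 0ℓ} → U.Decidable P → List A → List A
  longest P? [] = []
  longest P? (x ∷ xs) with P? x
  ... | no _  = longest P? xs
  ... | yes _ = longer (longest P? xs) (x ∷ longest (P? ∩? R? x) xs)

  pairwiseIn-∷ : ∀ {P x xs ys} → PairwiseIn P xs ys → PairwiseIn P (x ∷ xs) ys
  pairwiseIn-∷ (ys⊆xs , pys , rys) = there ∘ ys⊆xs , pys , rys

  longest-pairwiseIn : {P : Pred A 0ℓ} (P? : U.Decidable P) → ∀ xs → PairwiseIn P xs (longest P? xs)
  longest-pairwiseIn P? [] = (λ ()) , [] , []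
  longest-pairwiseIn {P} P? (x ∷ xs) with P? x
  ... | no _   = pairwiseIn-∷ (longest-pairwiseIn P? xs)
  ... | yes px = longer-preserves (PairwiseIn P (x ∷ xs)) (pairwiseIn-∷ (longest-pairwiseIn P? xs))
                   (extend (longest-pairwiseIn (P? ∩? R? x) xs))
    where
    extend : ∀ {ys} → PairwiseIn (P ∩ R x) xs ys → PairwiseIn P (x ∷ xs) (x ∷ ys)
    extend (ys⊆xs , prys , rys) = ∷⁺ʳ x ys⊆xs , px ∷ All.map proj₁ prys , All.map proj₂ prys ∷ rys

  module _ (_≟ᴬ_ : DecidableEquality A) (R-sym : Symmetric R) (R-irrefl : ∀ {x} → ¬ R x x) where

    open import Data.List.Membership.DecPropositional _≟ᴬ_ using (_∈?_)

    length-filter-∈ : ∀ {x ys} → AllPairs R ys → x ∈ ys → length ys ≡ suc (length (filter (R? x) ys))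
    length-filter-∈ {x} (x∼ys ∷ _) (here refl) =
      ≡.cong (suc ∘ length) (≡.sym (≡.trans (filter-reject (R? x) R-irrefl) (filter-all (R? x) x∼ys)))
    length-filter-∈ {x} (y∼ys ∷ pairwise) (there x∈ys) =
      ≡.cong suc (≡.trans (length-filter-∈ pairwise x∈ys)
                          (≡.cong length (≡.sym (filter-accept (R? x) (R-sym (All.lookup y∼ys x∈ys))))))

    filter-pairwiseIn : ∀ {P x xs ys} → PairwiseIn P (x ∷ xs) ys → PairwiseIn (P ∩ R x) xs (filter (R? x) ys)
    filter-pairwiseIn {x = x} {ys = ys} (ys⊆x∷xs , pys , rys) =
        ⊆∷∧∉⇒⊆ (ys⊆x∷xs ∘ proj₁ ∘ ∈-filter⁻ (R? x) {xs = ys})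
               (R-irrefl ∘ proj₂ ∘ ∈-filter⁻ (R? x) {xs = ys})
      , All.zipWith id (All.filter⁺ (R? x) pys , All.all-filter (R? x) ys)
      , AllPairs.filter⁺ (R? x) rys

    longest-maximal : {P : Pred A 0ℓ} (P? : U.Decidable P) → ∀ xs {ys} →
                      PairwiseIn P xs ys → length ys ≤ length (longest P? xs)
    longest-maximal P? [] {[]} _ = z≤n
    longest-maximal P? [] {_ ∷ _} (ys⊆[] , _) with ys⊆[] (here refl)
    ... | ()
    longest-maximal P? (x ∷ xs) {ys} ys-in@(ys⊆x∷xs , pys , rys) with P? x | x ∈? ys
    ... | no ¬px | yes x∈ys = contradiction (All.lookup pys x∈ys) ¬px
    ... | no _   | no x∉ys  = longest-maximal P? xs (⊆∷∧∉⇒⊆ ys⊆x∷xs x∉ys , pys , rys)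
    ... | yes _  | no x∉ys  =
      ≤-trans (longest-maximal P? xs (⊆∷∧∉⇒⊆ ys⊆x∷xs x∉ys , pys , rys))
              (length-longerˡ (longest P? xs) (x ∷ longest (P? ∩? R? x) xs))
    ... | yes _  | yes x∈ys = begin
      length ys                              ≡⟨ length-filter-∈ rys x∈ys ⟩
      suc (length (filter (R? x) ys))        ≤⟨ s≤s (longest-maximal (P? ∩? R? x) xs (filter-pairwiseIn ys-in)) ⟩
      suc (length (longest (P? ∩? R? x) xs)) ≤⟨ length-longerʳ (longest P? xs) _ ⟩
      length (longer (longest P? xs) (x ∷ longest (P? ∩? R? x) xs)) ∎
      where open ≤-Reasoning

module _ (G : Graph) where

  inEdges-mono : {M M′ : EdgeList G} → M ⊆ M′ → ∀ a b → T (inEdges {G} M a b) → T (inEdges {G} M′ a b)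
  inEdges-mono {M} M⊆M′ a b = any⁺ _ ∘ Any-resp-⊆ M⊆M′ ∘ any⁻ _ M

  removeEdges-adj-antitone : {M M′ : EdgeList G} → M ⊆ M′ →
    ∀ a b → T (adj (removeEdges G M′) a b) → T (adj (removeEdges G M) a b)
  removeEdges-adj-antitone M⊆M′ a b = T-∧-mono id (T-not-antitone (inEdges-mono M⊆M′ a b))

  reachWithin-removeEdges-antitone : {M M′ : EdgeList G} → M ⊆ M′ →
    ∀ k a b → T (reachWithin (removeEdges G M′) k a b) → T (reachWithin (removeEdges G M) k a b)
  reachWithin-removeEdges-antitone M⊆M′ zero a b = id
  reachWithin-removeEdges-antitone {M} {M′} M⊆M′ (suc k) a b =
    T-∨-mono (reach a b)
             (T-any-mono (λ w → T-∧-mono (reach a w) (removeEdges-adj-antitone M⊆M′ w b)) (allFin (n G)))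
    where
    reach : ∀ a b → T (reachWithin (removeEdges G M′) k a b) → T (reachWithin (removeEdges G M) k a b)
    reach = reachWithin-removeEdges-antitone M⊆M′ k

  isComponentRoot : EdgeList G → Fin (n G) → Bool
  isComponentRoot M v =
    all (λ w → not (⌊ w <ᶠ? v ⌋ ∧ connected (removeEdges G M) w v)) (allFin (n G))

  -- components counts least vertices of components; deleting edges keeps such a vertex least in its smaller component.
  components-removeEdges-mono : {M M′ : EdgeList G} → M ⊆ M′ →
    components (removeEdges G M) ≤ components (removeEdges G M′)
  components-removeEdges-mono {M} {M′} M⊆M′ =
    Sublist.length-mono-≤
      (Sublist.filter⁺ (root? M) (root? M′) (λ { refl → rootStays }) (Sublist.⊆-refl {x = allFin (n G)}))
    where
    root? : ∀ K v → Dec (isComponentRoot K v ≡ true)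
    root? K v = isComponentRoot K v Bool.≟ true
    rootStays : ∀ {v} → isComponentRoot M v ≡ true → isComponentRoot M′ v ≡ true
    rootStays = Equivalence.to T-≡ ∘ T-all-mono (λ w → T-not-antitone (T-∧-mono id
                  (reachWithin-removeEdges-antitone M⊆M′ (n G) w _))) (allFin (n G)) ∘ Equivalence.from T-≡

module Matchings (G : Graph) where

  Vertex : Set
  Vertex = Fin (n G)

  Edge : Set
  Edge = Vertex × Vertex

  _≟ᴱ_ : DecidableEquality Edge
  _≟ᴱ_ = ≡-dec _≟_ _≟_

  IsEdge : Pred Edge 0ℓ
  IsEdge (a , b) = adj G a b ≡ true

  IsEdge? : U.Decidable IsEdge
  IsEdge? (a , b) = adj G a b Bool.≟ true

  ends : Edge → List Vertex
  ends (a , b) = a ∷ b ∷ []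

  Avoids : Vertex → Pred Edge 0ℓ
  Avoids x e = All (x ≢_) (ends e)

  Avoids? : ∀ x → U.Decidable (Avoids x)
  Avoids? x e = All.all? (λ y → ¬? (x ≟ y)) (ends e)

  Disjoint : Rel Edge 0ℓ
  Disjoint e f = All (λ x → Avoids x f) (ends e)

  Disjoint? : Decidable Disjoint
  Disjoint? e f = All.all? (λ x → Avoids? x f) (ends e)

  Disjoint-sym : Symmetric Disjoint
  Disjoint-sym = All.map (All.map ≢-sym) ∘ All.All-swap

  Disjoint-irrefl : ∀ {e} → ¬ Disjoint e e
  Disjoint-irrefl ((a≢a ∷ _) ∷ _) = a≢a refl

  Disjoint⇒Avoids : ∀ x {e f} → Disjoint e f → Avoids x e ⊎ Avoids x f
  Disjoint⇒Avoids x {a , b} (a-avoids-f ∷ b-avoids-f ∷ []) with x ≟ a | x ≟ b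
  ... | yes refl | _        = inj₂ a-avoids-f
  ... | no _     | yes refl = inj₂ b-avoids-f
  ... | no x≢a   | no x≢b   = inj₁ (x≢a ∷ x≢b ∷ [])

  adj⇒≢ : ∀ {a b} → adj G a b ≡ true → a ≢ b
  adj⇒≢ {a} ab refl with ≡.trans (≡.sym ab) (irrefl G a)
  ... | ()

  matching⇒pairwiseDisjoint : ∀ N → Unique (endpoints {G} N) → AllPairs Disjoint N
  matching⇒pairwiseDisjoint [] [] = []
  matching⇒pairwiseDisjoint (e ∷ N) ((_ ∷ a-avoids-N) ∷ b-avoids-N ∷ unique) =
    All.zipWith (λ (a-avoids-f , b-avoids-f) → a-avoids-f ∷ b-avoids-f ∷ [])
                (avoidsAll a-avoids-N , avoidsAll b-avoids-N)
    ∷ matching⇒pairwiseDisjoint N unique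
    where
    avoidsAll : ∀ {x} → All (x ≢_) (endpoints {G} N) → All (Avoids x) N
    avoidsAll = All.map⁻ ∘ All.concat⁻

  pairwiseDisjoint⇒matching : ∀ M → All IsEdge M → AllPairs Disjoint M → IsMatching G M
  pairwiseDisjoint⇒matching M edges disjoint =
    edges , AllPairs.concat⁺ (All.map⁺ (All.map endsDistinct edges)) (AllPairs.map⁺ disjoint)
    where
    endsDistinct : ∀ {e} → IsEdge e → Unique (ends e)
    endsDistinct ab = (adj⇒≢ ab ∷ []) ∷ [] ∷ []

  withoutEnds : Edge → List Edge → List Edge
  withoutEnds (u , v) = filter (Avoids? v) ∘ filter (Avoids? u)

  withoutEnds-Disjoint : ∀ e N → All (Disjoint e) (withoutEnds e N)
  withoutEnds-Disjoint (u , v) N =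
    All.zipWith (λ (avoids-u , avoids-v) → avoids-u ∷ avoids-v ∷ [])
      ( All.filter⁺ (Avoids? v) (All.all-filter (Avoids? u) N)
      , All.all-filter (Avoids? v) (filter (Avoids? u) N))

  withoutEnds-All : ∀ {P : Pred Edge 0ℓ} e {N} → All P N → All P (withoutEnds e N)
  withoutEnds-All (u , v) = All.filter⁺ (Avoids? v) ∘ All.filter⁺ (Avoids? u)

  withoutEnds-AllPairs : ∀ {R : Rel Edge 0ℓ} e {N} → AllPairs R N → AllPairs R (withoutEnds e N)
  withoutEnds-AllPairs (u , v) = AllPairs.filter⁺ (Avoids? v) ∘ AllPairs.filter⁺ (Avoids? u)

  length-withoutEnds : ∀ e {N} → AllPairs Disjoint N → length N ≤ 2 + length (withoutEnds e N)
  length-withoutEnds (u , v) disjoint =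
    ≤-trans (length≤suc-length-filter (Avoids? u) (Disjoint⇒Avoids u) disjoint)
            (s≤s (length≤suc-length-filter (Avoids? v) (Disjoint⇒Avoids v)
                   (AllPairs.filter⁺ (Avoids? u) disjoint)))

  allEdges : List Edge
  allEdges = cartesianProduct (allFin (n G)) (allFin (n G))

  ∈-allEdges : ∀ e → e ∈ allEdges
  ∈-allEdges (a , b) = ∈-cartesianProduct⁺ (∈-allFin a) (∈-allFin b)

  open LongestPairwise Disjoint?

  maxMatchingAvoiding : Edge → List Edge
  maxMatchingAvoiding e = longest (IsEdge? ∩? Disjoint? e) allEdges

  ∷-maxMatchingAvoiding : ∀ {e} → IsEdge e → IsMatching G (e ∷ maxMatchingAvoiding e)
  ∷-maxMatchingAvoiding {e} e-edge with longest-pairwiseIn (IsEdge? ∩? Disjoint? e) allEdges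
  ... | _ , edges , disjoint =
    pairwiseDisjoint⇒matching _ (e-edge ∷ All.map proj₁ edges) (All.map proj₂ edges ∷ disjoint)

  length≤2+maxMatchingAvoiding : ∀ e N → IsMatching G N → length N ≤ 2 + length (maxMatchingAvoiding e)
  length≤2+maxMatchingAvoiding e N (edges , unique) = begin
    length N                           ≤⟨ length-withoutEnds e disjoint ⟩
    2 + length (withoutEnds e N)       ≤⟨ s≤s (s≤s (longest-maximal _≟ᴱ_ Disjoint-sym Disjoint-irrefl
                                                                      _ allEdges rest)) ⟩
    2 + length (maxMatchingAvoiding e) ∎
    where
    open ≤-Reasoning
    disjoint : AllPairs Disjoint N
    disjoint = matching⇒pairwiseDisjoint N unique
    rest : PairwiseIn (IsEdge ∩ Disjoint e) allEdges (withoutEnds e N)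
    rest = (λ {f} _ → ∈-allEdges f)
         , All.zipWith id (withoutEnds-All e edges , withoutEnds-Disjoint e N)
         , withoutEnds-AllPairs e disjoint

theorem3 : (G : Graph) → Cubic G → Decomposable G → HasBridge G →
    Σ (EdgeList G) λ M → IsSeparatingMatching G M ×
      ((N : EdgeList G) → IsMatching G N → length N ≤ length M + 1)
theorem3 G _ _ (u , v , uv-edge , uv-bridge) = M , (M-matching , M-separating) , M-maximum
  where
  open Matchings G

  L M : EdgeList G
  L = maxMatchingAvoiding (u , v)
  M = (u , v) ∷ L

  M-matching : IsMatching G M
  M-matching = ∷-maxMatchingAvoiding uv-edge

  M-separating : components G < components (removeEdges G M)
  M-separating = <-≤-trans uv-bridge (components-removeEdges-mono G (λ { (here refl) → here refl }))

  M-maximum : (N : EdgeList G) → IsMatching G N → length N ≤ length M + 1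
  M-maximum N N-matching = begin
    length N      ≤⟨ length≤2+maxMatchingAvoiding (u , v) N N-matching ⟩
    2 + length L  ≡⟨ ≡.cong suc (+-comm 1 (length L)) ⟩
    length M + 1  ∎
    where open ≤-Reasoning
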